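{- Let $P = P_1 \oplus \cdots \oplus P_r$ be a finite poset written as an ordinal sum of non-empty posets $P_1,\dots,P_r$, where no $P_i$ can be written as an ordinal sum of two strictly smaller non-empty posets. Then the sizes $|P_1|, \ldots, |P_r|$ can be recovered from $\Phi(P ; s, t, x, y, z)$; that is, if $Q=Q_1\oplus\cdots\oplus Q_m$ is another such decomposition of a finite poset $Q$ (each $Q_j$ non-empty and not an ordinal sum of two strictly smaller non-empty posets) and $\Phi(P;s,t,x,y,z)=\Phi(Q;s,t,x,y,z)$, then $m=r$ and $|Q_i|=|P_i|$ for all $i$.
   Context: All posets are finite. For a poset $P$, a set $U\subseteq P$ is an upset if $u\in U$, $u\le v$ imply $v\in U$; a set $D\subseteq P$ is a downset if $v\in D$, $u\le v$ imply $u\in D$ (the empty set is both). For an upset $U$, $A(U)$ denotes the antichain of minimal elements of $U$; for a downset $D$, $A(D)$ denotes the antichain of maximal elements of $D$. For an upset $U$ and downset $D$ write $U\preceq D$ if $A(U)\subseteq D$ and $A(D)\subseteq U$. The generalized interval polynomial is \[\Phi(P;s,t,x,y,z)=\sum_{U\preceq D} s^{|A(U)|}t^{|A(D)|}x^{|D|}y^{|U|}z^{|U\cap D|},\] summed over all upset/downset pairs $U\preceq D$ of $P$ (including $U=D=\emptyset$). The ordinal sum $P\oplus Q$ of posets on disjoint sets has underlying set $P\cup Q$, with the relations of $P$ and $Q$ together with $u\le v$ for all $u\in P$, $v\in Q$; the iterated ordinal sum $P_1\oplus\cdots\oplus P_r$ is defined by associativity. -}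

module Defs where

open import Data.Nat using (ℕ; zero; suc; _+_; _<_)
open import Data.Bool using (Bool; true; false; _∧_; _∨_; not; T; if_then_else_)
open import Data.Fin using (Fin; splitAt; _≟_)
open import Data.Fin.Subset using (Subset; _∈_; _∉_; ∁; Nonempty)
open import Data.Vec using (Vec; []; _∷_; lookup)
open import Data.List using (List; []; _∷_; _++_; map; filter; length; foldr; allFin; concatMap)
import Data.List as List
open import Data.Sum using (inj₁; inj₂)
open import Data.Product using (Σ; ∃; _×_; _,_)
open import Relation.Nullary using (¬_; does)
open import Relation.Binary.PropositionalEquality using (_≡_)
open import Relation.Binary.Structures using (IsPartialOrder)

-- A finite "relational structure": carrier Fin size, with a Boolean
-- (hence decidable) relation.  Being a poset is a separate predicate.

record FinRel : Set where
  constructor mkFinRel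
  field
    size : ℕ
    rel  : Fin size → Fin size → Bool

open FinRel public

IsFinPoset : FinRel → Set
IsFinPoset P = IsPartialOrder _≡_ (λ i j → T (rel P i j))

NonEmptyPoset : FinRel → Set
NonEmptyPoset P = 0 < size P

_⊕_ : FinRel → FinRel → FinRel
P ⊕ Q = mkFinRel (size P + size Q) r
  where
  r : Fin (size P + size Q) → Fin (size P + size Q) → Bool
  r i j with splitAt (size P) i | splitAt (size P) j
  ... | inj₁ a | inj₁ b = rel P a b
  ... | inj₂ a | inj₂ b = rel Q a b
  ... | inj₁ _ | inj₂ _ = true
  ... | inj₂ _ | inj₁ _ = false

emptyPoset : FinRel
emptyPoset = mkFinRel 0 (λ ())

⨁ : List FinRel → FinRel
⨁ = foldr _⊕_ emptyPoset

-- P can be written as an ordinal sum of two strictly smaller non-empty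
-- posets: its carrier splits into non-empty parts X and (complement X)
-- (with the induced orders) such that every element of X is below every
-- element of the complement.
OrdinallyDecomposable : FinRel → Set
OrdinallyDecomposable P =
  ∃ λ (X : Subset (size P)) →
    Nonempty X × Nonempty (∁ X) ×
    (∀ i j → i ∈ X → j ∉ X → T (rel P i j))

Component : FinRel → Set
Component P = IsFinPoset P × NonEmptyPoset P × ¬ OrdinallyDecomposable P

allSubsets : (n : ℕ) → List (Subset n)
allSubsets zero    = [] ∷ []
allSubsets (suc n) = map (true ∷_) (allSubsets n) ++ map (false ∷_) (allSubsets n)

module _ (P : FinRel) where
  private
    n = size P
    _≤_ : Fin n → Fin n → Bool
    _≤_ = rel P
    mem : Subset n → Fin n → Bool
    mem S i = lookup S i
    all : (Fin n → Bool) → Bool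
    all f = foldr (λ i acc → f i ∧ acc) true (allFin n)
    _⇒_ : Bool → Bool → Bool
    a ⇒ b = not a ∨ b
    eq : Fin n → Fin n → Bool
    eq i j = does (i ≟ j)

  card : Subset n → ℕ
  card S = length (filter (λ i → T? (mem S i)) (allFin n))
    where
    open import Data.Bool using (T?)

  isUpset : Subset n → Bool
  isUpset U = all λ u → all λ v → (mem U u ∧ (u ≤ v)) ⇒ mem U v

  isDownset : Subset n → Bool
  isDownset D = all λ v → all λ u → (mem D v ∧ (u ≤ v)) ⇒ mem D u

  minimals : Subset n → Subset n
  minimals U = Data.Vec.tabulate λ u → mem U u ∧ (all λ w → (mem U w ∧ (w ≤ u)) ⇒ eq w u)

  maximals : Subset n → Subset n
  maximals D = Data.Vec.tabulate λ v → mem D v ∧ (all λ w → (mem D w ∧ (v ≤ w)) ⇒ eq w v)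

  subsetB : Subset n → Subset n → Bool
  subsetB S T' = all λ i → mem S i ⇒ mem T' i

  inter : Subset n → Subset n → Subset n
  inter S T' = Data.Vec.tabulate λ i → mem S i ∧ mem T' i

  isPair : Subset n → Subset n → Bool
  isPair U D = isUpset U ∧ isDownset D ∧ subsetB (minimals U) D ∧ subsetB (maximals D) U

  -- Coefficient of s^a t^b x^c y^d z^e in Φ(P; s,t,x,y,z): the number of
  -- pairs U ⪯ D with |A(U)| = a, |A(D)| = b, |D| = c, |U| = d, |U ∩ D| = e.
  Φ-coeff : ℕ → ℕ → ℕ → ℕ → ℕ → ℕ
  Φ-coeff a b c d e =
    length (filter (λ p → T? (match p)) pairs)
    where
    open import Data.Bool using (T?)
    open import Data.Nat using (_≡ᵇ_)
    pairs : List (Σ (Subset n) (λ _ → Subset n))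
    pairs = concatMap (λ U → map (λ D → U , D) (allSubsets n)) (allSubsets n)
    match : Σ (Subset n) (λ _ → Subset n) → Bool
    match (U , D) = isPair U D
      ∧ (card (minimals U) ≡ᵇ a) ∧ (card (maximals D) ≡ᵇ b)
      ∧ (card D ≡ᵇ c) ∧ (card U ≡ᵇ d) ∧ (card (inter U D) ≡ᵇ e)

SamePhi : FinRel → FinRel → Set
SamePhi P Q = ∀ a b c d e → Φ-coeff P a b c d e ≡ Φ-coeff Q a b c d e

module Submission where

-- Call (|↓x|, |↑x|) the profile of an element x.  Φ(P) determines |P| (the pair
-- ⊤ ⪯ ⊤ has |D| = |P|, and no pair has more) and the set of profiles of P: the pairs U ⪯ D with
-- |A(U)| = |A(D)| = |U ∩ D| = 1 are exactly ↑x ⪯ ↓x, contributing s t x^|↓x| y^|↑x| z.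
-- In P₁ ⊕ T, with k = |P₁|, the elements of P₁ are exactly those with |↓x| ≤ k, and exactly
-- those with |↑x| > |T|.  If Q₁ ⊕ T′ has the same size and profiles and k < |Q₁|, this
-- description transfers to Q₁ ⊕ T′ and restricts to Q₁.  There X = {x : |↓x| ≤ k} is non-empty,
-- misses a maximal element, and lies below its complement, so Q₁ decomposes.  Hence |P₁| = |Q₁|;
-- the profiles of T and T′ then agree, and induction on the number of components finishes.

open import Defs
open import Data.List using (List; []; _∷_; map; allFin; foldr; filter; length; concatMap)
open import Data.List.Relation.Unary.All using (All; []; _∷_)
open import Relation.Binary.PropositionalEquality using (_≡_)

open import Data.Bool using (Bool; true; false; T; T?; not; _∧_; _∨_)
open import Data.Bool.Properties using (T-≡; T-∧)
open import Data.Unit using (tt)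
open import Data.Nat using (ℕ; zero; suc; _+_; _≤_; _<_; z≤n; s≤s; s≤s⁻¹; _≤ᵇ_; _≡ᵇ_)
open import Data.Nat.Properties
  using ( ≤-trans; ≤-reflexive; <-irrefl; <-≤-trans; ≤-antisym; +-monoʳ-≤; +-monoˡ-≤; +-monoˡ-<
        ; n≤1+n; m≤m+n; m<m+n; +-suc; +-comm; +-assoc; +-identityʳ; ≤⇒≯; <⇒≱; ≰⇒>; ≮⇒≥
        ; m+[n∸m]≡n; +-cancelˡ-≤; +-cancelʳ-<; +-cancelˡ-≡; ≤ᵇ⇒≤; ≤⇒≤ᵇ; ≡ᵇ⇒≡; ≡⇒≡ᵇ )
open Data.Nat.Properties.≤-Reasoning
open import Data.Fin using (Fin; zero; suc; _↑ˡ_; _↑ʳ_; splitAt; fromℕ<; _≟_)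
open import Data.Fin.Properties using (splitAt-↑ˡ; splitAt-↑ʳ; splitAt⁻¹-↑ˡ; splitAt⁻¹-↑ʳ)
open import Data.Fin.Subset
  using (Subset; _∈_; _∉_; _⊆_; _∪_; ∁; ⁅_⁆; ∣_∣; ⊤; inside; outside)
open import Data.Fin.Subset.Properties
  using ( p⊂q⇒∣p∣<∣q∣; p⊆q⇒∣p∣≤∣q∣; _∈?_; nonempty?; Empty-unique; ∣⊥∣≡0; ∣⊤∣≡n; ∣⁅x⁆∣≡1
        ; x∈⁅y⁆⇒x≡y; x∈⁅y⁆⇔x≡y; ⊆-antisym; ∣∁p∣≡n∸∣p∣; ∣p∣≤n; x∉p⇒x∈∁p; x∈∁p⇒x∉p
        ; x∈p∪q⁺; ∈⊤ )
open import Data.Vec using ([]; _∷_; tabulate; lookup)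
open import Data.Vec.Properties
  using (lookup∘tabulate; lookup⇒[]=; []=⇒lookup; tabulate-cong; tabulate∘lookup)
import Data.List as List
import Data.List.Relation.Unary.All as All
import Data.List.Relation.Unary.Any as Any
open import Data.List.Relation.Unary.Any using (here; there)
import Data.List.Membership.Propositional as List
open import Data.List.Membership.Propositional.Properties
  using (∈-allFin; ∈-filter⁺; ∈-filter⁻; ∈-map⁺; ∈-++⁺ˡ; ∈-++⁺ʳ; ∈-concatMap⁺)
open import Data.Sum using (_⊎_; inj₁; inj₂)
open import Data.Product using (∃; ∃₂; _×_; _,_; proj₁; proj₂)
open import Data.Product.Function.NonDependent.Propositional using (_×-⇔_)
open import Function using (_∘_; flip; _⇔_; mk⇔; Equivalence)
import Function.Properties.Equivalence as ⇔
open import Relation.Nullary using (¬_; does; yes; no; contradiction)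
open import Relation.Nullary.Decidable using (_×-dec_)
open import Relation.Binary.Core using (Rel)
open import Relation.Binary.Definitions using (Decidable)
open import Relation.Binary.Structures using (IsPartialOrder)
import Relation.Binary.Construct.Flip.EqAndOrd as Flip
open import Relation.Binary.PropositionalEquality
  using (refl; sym; trans; cong; cong₂; subst; isEquivalence)

open Equivalence using (to; from)

∣p∪q∣≤∣p∣+∣q∣ : ∀ {n} (p q : Subset n) → ∣ p ∪ q ∣ ≤ ∣ p ∣ + ∣ q ∣
∣p∪q∣≤∣p∣+∣q∣ []            []            = z≤n
∣p∪q∣≤∣p∣+∣q∣ (outside ∷ p) (outside ∷ q) = ∣p∪q∣≤∣p∣+∣q∣ p q
∣p∪q∣≤∣p∣+∣q∣ (inside  ∷ p) (outside ∷ q) = s≤s (∣p∪q∣≤∣p∣+∣q∣ p q)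
∣p∪q∣≤∣p∣+∣q∣ (outside ∷ p) (inside  ∷ q) =
  subst (suc ∣ p ∪ q ∣ ≤_) (sym (+-suc ∣ p ∣ ∣ q ∣)) (s≤s (∣p∪q∣≤∣p∣+∣q∣ p q))
∣p∪q∣≤∣p∣+∣q∣ (inside  ∷ p) (inside  ∷ q) =
  s≤s (≤-trans (∣p∪q∣≤∣p∣+∣q∣ p q) (+-monoʳ-≤ ∣ p ∣ (n≤1+n ∣ q ∣)))

∣p∣+∣∁p∣≡n : ∀ {n} (p : Subset n) → ∣ p ∣ + ∣ ∁ p ∣ ≡ n
∣p∣+∣∁p∣≡n p = trans (cong (∣ p ∣ +_) (∣∁p∣≡n∸∣p∣ p)) (m+[n∸m]≡n (∣p∣≤n p))

p⊆q∧∣q∣≤∣p∣⇒q⊆p : ∀ {n} {p q : Subset n} → p ⊆ q → ∣ q ∣ ≤ ∣ p ∣ → q ⊆ p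
p⊆q∧∣q∣≤∣p∣⇒q⊆p {p = p} p⊆q ∣q∣≤∣p∣ {x} x∈q with x ∈? p
... | yes x∈p = x∈p
... | no  x∉p = contradiction (p⊂q⇒∣p∣<∣q∣ (p⊆q , x , x∈q , x∉p)) (≤⇒≯ ∣q∣≤∣p∣)

x∈p⇒⁅x⁆⊆p : ∀ {n} {p : Subset n} {x} → x ∈ p → ⁅ x ⁆ ⊆ p
x∈p⇒⁅x⁆⊆p {p = p} {x} x∈p y∈⁅x⁆ = subst (_∈ p) (sym (x∈⁅y⁆⇒x≡y x y∈⁅x⁆)) x∈p

p⊆⁅x⁆⇒∣p∣≤1 : ∀ {n} {p : Subset n} {x} → p ⊆ ⁅ x ⁆ → ∣ p ∣ ≤ 1
p⊆⁅x⁆⇒∣p∣≤1 {x = x} p⊆⁅x⁆ = ≤-trans (p⊆q⇒∣p∣≤∣q∣ p⊆⁅x⁆) (≤-reflexive (∣⁅x⁆∣≡1 x))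

∣p∣≡1⇒p≡⁅x⁆ : ∀ {n} (p : Subset n) → ∣ p ∣ ≡ 1 → ∃ λ x → p ≡ ⁅ x ⁆
∣p∣≡1⇒p≡⁅x⁆ {n} p ∣p∣≡1 with nonempty? p
... | no  empty =
  contradiction (trans (sym ∣p∣≡1) (trans (cong ∣_∣ (Empty-unique empty)) (∣⊥∣≡0 n))) λ ()
... | yes (x , x∈p) = x , ⊆-antisym (p⊆q∧∣q∣≤∣p∣⇒q⊆p (x∈p⇒⁅x⁆⊆p x∈p) ∣p∣≤∣⁅x⁆∣) (x∈p⇒⁅x⁆⊆p x∈p)
  where
  ∣p∣≤∣⁅x⁆∣ : ∣ p ∣ ≤ ∣ ⁅ x ⁆ ∣
  ∣p∣≤∣⁅x⁆∣ = ≤-reflexive (trans ∣p∣≡1 (sym (∣⁅x⁆∣≡1 x)))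

x∈p∧unique⇒p≡⁅x⁆ : ∀ {n} {p : Subset n} {x} → x ∈ p → (∀ {y} → y ∈ p → y ≡ x) → p ≡ ⁅ x ⁆
x∈p∧unique⇒p≡⁅x⁆ x∈p unique = ⊆-antisym (from x∈⁅y⁆⇔x≡y ∘ unique) (x∈p⇒⁅x⁆⊆p x∈p)

∈-≡⁅x⁆ : ∀ {n} {p : Subset n} {x y} → p ≡ ⁅ x ⁆ → y ∈ p ⇔ y ≡ x
∈-≡⁅x⁆ refl = x∈⁅y⁆⇔x≡y

∈-tabulate : ∀ {n} {f : Fin n → Bool} {i} → i ∈ tabulate f ⇔ T (f i)
∈-tabulate {f = f} {i} = mk⇔
  (λ i∈ → from T-≡ (trans (sym (lookup∘tabulate f i)) ([]=⇒lookup i∈)))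
  (λ fi → lookup⇒[]= i (tabulate f) (trans (lookup∘tabulate f i) (to T-≡ fi)))

∣tabulate-false∣ : ∀ n → ∣ tabulate {n = n} (λ _ → false) ∣ ≡ 0
∣tabulate-false∣ zero    = refl
∣tabulate-false∣ (suc n) = ∣tabulate-false∣ n

∣tabulate-true∣ : ∀ n → ∣ tabulate {n = n} (λ _ → true) ∣ ≡ n
∣tabulate-true∣ zero    = refl
∣tabulate-true∣ (suc n) = cong suc (∣tabulate-true∣ n)

∣tabulate∣-↑ : ∀ m {n} (f : Fin (m + n) → Bool) →
  ∣ tabulate f ∣ ≡ ∣ tabulate (f ∘ (_↑ˡ n)) ∣ + ∣ tabulate (f ∘ (m ↑ʳ_)) ∣
∣tabulate∣-↑ zero    f = refl
∣tabulate∣-↑ (suc m) f with f zero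
... | true  = cong suc (∣tabulate∣-↑ m (f ∘ suc))
... | false = ∣tabulate∣-↑ m (f ∘ suc)

∣tabulate∣-↑-cong : ∀ m {n} {f : Fin (m + n) → Bool} {g h} →
  (∀ i → f (i ↑ˡ n) ≡ g i) → (∀ j → f (m ↑ʳ j) ≡ h j) →
  ∣ tabulate f ∣ ≡ ∣ tabulate g ∣ + ∣ tabulate h ∣
∣tabulate∣-↑-cong m {f = f} f≗g f≗h =
  trans (∣tabulate∣-↑ m f) (cong₂ (λ u v → ∣ u ∣ + ∣ v ∣) (tabulate-cong f≗g) (tabulate-cong f≗h))

module _ {ℓ} {n : ℕ} (_≼_ : Rel (Fin n) ℓ) where

  IsMinimal : Subset n → Fin n → Set ℓ
  IsMinimal S w = w ∈ S × (∀ {v} → v ∈ S → v ≼ w → v ≡ w)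

  IsMaximal : Subset n → Fin n → Set ℓ
  IsMaximal S w = w ∈ S × (∀ {v} → v ∈ S → w ≼ v → v ≡ w)

module Minimal {ℓ} {n : ℕ} {_≼_ : Rel (Fin n) ℓ}
               (po : IsPartialOrder _≡_ _≼_) (_≼?_ : Decidable _≼_) where
  open IsPartialOrder po using (antisym) renaming (refl to ≼-refl; trans to ≼-trans)

  -- Scanning all elements and moving down to each element of S below the current
  -- candidate ends at a minimal element: an element of S below the final candidate
  -- was, at its turn, below the candidate of that time, so it was taken.
  private
    descend : Subset n → List (Fin n) → Fin n → Fin n
    descend S []       w = w
    descend S (i ∷ is) w with i ∈? S ×-dec i ≼? w
    ... | yes _ = descend S is i
    ... | no  _ = descend S is w

    descend-∈ : ∀ {S w} is → w ∈ S → descend S is w ∈ S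
    descend-∈         []       w∈S = w∈S
    descend-∈ {S} {w} (i ∷ is) w∈S with i ∈? S ×-dec i ≼? w
    ... | yes (i∈S , _) = descend-∈ is i∈S
    ... | no  _         = descend-∈ is w∈S

    descend-≼ : ∀ {S} is w → descend S is w ≼ w
    descend-≼     []       w = ≼-refl
    descend-≼ {S} (i ∷ is) w with i ∈? S ×-dec i ≼? w
    ... | yes (_ , i≼w) = ≼-trans (descend-≼ is i) i≼w
    ... | no  _         = descend-≼ is w

    descend-minimal : ∀ {S v} is w → v List.∈ is → v ∈ S → v ≼ descend S is w →
                      v ≡ descend S is w
    descend-minimal {S} (i ∷ is) w (here refl) i∈S i≼d with i ∈? S ×-dec i ≼? w
    ... | yes _   = antisym i≼d (descend-≼ is i)
    ... | no  i∉↓ = contradiction (i∈S , ≼-trans i≼d (descend-≼ is w)) i∉↓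
    descend-minimal {S} (i ∷ is) w (there v∈is) v∈S v≼d with i ∈? S ×-dec i ≼? w
    ... | yes _ = descend-minimal is i v∈is v∈S v≼d
    ... | no  _ = descend-minimal is w v∈is v∈S v≼d

  minimal-below : ∀ {S u} → u ∈ S → ∃ λ w → IsMinimal _≼_ S w × w ≼ u
  minimal-below {S} {u} u∈S =
    descend S (allFin n) u ,
    (descend-∈ (allFin n) u∈S , descend-minimal (allFin n) u (∈-allFin _)) ,
    descend-≼ (allFin n) u

module Maximal {ℓ} {n : ℕ} {_≼_ : Rel (Fin n) ℓ}
               (po : IsPartialOrder _≡_ _≼_) (_≼?_ : Decidable _≼_) where
  open Minimal (Flip.isPartialOrder po) (flip _≼?_) public
    renaming (minimal-below to maximal-above)

-- Finite posets, profiles and cuts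

module Order (P : FinRel) where
  _≼_ : Fin (size P) → Fin (size P) → Set
  i ≼ j = T (rel P i j)

  ↓_ : Fin (size P) → Subset (size P)
  ↓ x = tabulate (λ w → rel P w x)

  ↑_ : Fin (size P) → Subset (size P)
  ↑ x = tabulate (rel P x)

  IsUpset : Subset (size P) → Set
  IsUpset U = ∀ {u v} → u ∈ U → u ≼ v → v ∈ U

  IsDownset : Subset (size P) → Set
  IsDownset D = ∀ {v u} → v ∈ D → u ≼ v → u ∈ D

dual : FinRel → FinRel
dual P = mkFinRel (size P) (flip (rel P))

Profile : FinRel → ℕ → ℕ → Set
Profile P c d = ∃ λ x → ∣ ↓ x ∣ ≡ c × ∣ ↑ x ∣ ≡ d
  where open Order P

profile-≤ : ∀ {P c d} → Profile P c d → c ≤ size P × d ≤ size P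
profile-≤ {P} (x , refl , refl) = ∣p∣≤n (↓ x) , ∣p∣≤n (↑ x)
  where open Order P

-- Stated through profiles only, so that it transfers to posets with the same size and profiles.
CutsAt : FinRel → ℕ → Set
CutsAt P k = ∀ {c d} → Profile P c d → c ≤ k ⇔ size P < d + k

module FinPoset {P : FinRel} (po : IsFinPoset P) where
  open Order P public
  open IsPartialOrder po public using (antisym) renaming (refl to ≼-refl; trans to ≼-trans)

  _≼?_ : Decidable _≼_
  i ≼? j = T? (rel P i j)

  open Minimal po _≼?_ public
  open Maximal po _≼?_ public

  x∈↓x : ∀ {x} → x ∈ ↓ x
  x∈↓x = from ∈-tabulate ≼-refl

  x∈↑x : ∀ {x} → x ∈ ↑ x
  x∈↑x = from ∈-tabulate ≼-refl

  0<∣↓x∣ : ∀ {x} → 0 < ∣ ↓ x ∣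
  0<∣↓x∣ {x} = ≤-trans (≤-reflexive (sym (∣⁅x⁆∣≡1 x))) (p⊆q⇒∣p∣≤∣q∣ (x∈p⇒⁅x⁆⊆p x∈↓x))

  0<∣↑x∣ : ∀ {x} → 0 < ∣ ↑ x ∣
  0<∣↑x∣ {x} = ≤-trans (≤-reflexive (sym (∣⁅x⁆∣≡1 x))) (p⊆q⇒∣p∣≤∣q∣ (x∈p⇒⁅x⁆⊆p x∈↑x))

  profile-positive : ∀ {c d} → Profile P c d → 0 < c × 0 < d
  profile-positive (x , refl , refl) = 0<∣↓x∣ , 0<∣↑x∣

  minimal-element : Fin (size P) → ∃ λ x → ∣ ↓ x ∣ ≤ 1
  minimal-element u with minimal-below (∈⊤ {x = u})
  ... | m , (_ , m-min) , _ =
    m , p⊆⁅x⁆⇒∣p∣≤1 (λ w∈↓m → from x∈⁅y⁆⇔x≡y (m-min ∈⊤ (to ∈-tabulate w∈↓m)))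

  maximal-element : Fin (size P) → ∃ λ x → ∣ ↑ x ∣ ≤ 1
  maximal-element u with maximal-above (∈⊤ {x = u})
  ... | m , (_ , m-max) , _ =
    m , p⊆⁅x⁆⇒∣p∣≤1 (λ w∈↑m → from x∈⁅y⁆⇔x≡y (m-max ∈⊤ (to ∈-tabulate w∈↑m)))

  cutsAt⇒ordinallyDecomposable : ∀ {k} → 0 < k → k < size P → CutsAt P k → OrdinallyDecomposable P
  cutsAt⇒ordinallyDecomposable {k} 0<k k<n cuts =
    X , (x₀ , x₀∈X) , (y₀ , x∉p⇒x∈∁p y₀∉X) , X≼∁X
    where
    n : ℕ
    n = size P

    X : Subset n
    X = tabulate (λ x → ∣ ↓ x ∣ ≤ᵇ k)

    ∈X⇔ : ∀ {x} → x ∈ X ⇔ ∣ ↓ x ∣ ≤ k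
    ∈X⇔ = mk⇔ (≤ᵇ⇒≤ _ _ ∘ to ∈-tabulate) (from ∈-tabulate ∘ ≤⇒≤ᵇ)

    bottom : ∃ λ x → ∣ ↓ x ∣ ≤ 1
    bottom = minimal-element (fromℕ< k<n)

    top : ∃ λ x → ∣ ↑ x ∣ ≤ 1
    top = maximal-element (fromℕ< k<n)

    x₀ y₀ : Fin n
    x₀ = proj₁ bottom
    y₀ = proj₁ top

    x₀∈X : x₀ ∈ X
    x₀∈X = from ∈X⇔ (≤-trans (proj₂ bottom) 0<k)

    y₀∉X : y₀ ∉ X
    y₀∉X y₀∈X = <-irrefl refl (<-≤-trans (to (cuts (y₀ , refl , refl)) (to ∈X⇔ y₀∈X))
      (≤-trans (+-monoˡ-≤ k (proj₂ top)) k<n))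

    -- For x₁ maximal in X, ↑x₁ ⊆ {x₁} ∪ ∁X, and |↑x₁| > |P| − k.
    ∣X∣≤k : ∣ X ∣ ≤ k
    ∣X∣≤k with maximal-above x₀∈X
    ... | x₁ , (x₁∈X , x₁-max) , _ = +-cancelˡ-≤ ∣ ∁ X ∣ ∣ X ∣ k (s≤s⁻¹ (begin-strict
      ∣ ∁ X ∣ + ∣ X ∣          ≡⟨ +-comm ∣ ∁ X ∣ ∣ X ∣ ⟩
      ∣ X ∣ + ∣ ∁ X ∣          ≡⟨ ∣p∣+∣∁p∣≡n X ⟩
      n                        <⟨ to (cuts (x₁ , refl , refl)) (to ∈X⇔ x₁∈X) ⟩
      ∣ ↑ x₁ ∣ + k             ≤⟨ +-monoˡ-≤ k (p⊆q⇒∣p∣≤∣q∣ ↑x₁⊆⁅x₁⁆∪∁X) ⟩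
      ∣ ⁅ x₁ ⁆ ∪ ∁ X ∣ + k     ≤⟨ +-monoˡ-≤ k (∣p∪q∣≤∣p∣+∣q∣ ⁅ x₁ ⁆ (∁ X)) ⟩
      ∣ ⁅ x₁ ⁆ ∣ + ∣ ∁ X ∣ + k ≡⟨ cong (λ m → m + ∣ ∁ X ∣ + k) (∣⁅x⁆∣≡1 x₁) ⟩
      suc (∣ ∁ X ∣ + k)        ∎))
      where
      ↑x₁⊆⁅x₁⁆∪∁X : ↑ x₁ ⊆ ⁅ x₁ ⁆ ∪ ∁ X
      ↑x₁⊆⁅x₁⁆∪∁X {w} w∈↑x₁ with w ∈? X
      ... | yes w∈X = x∈p∪q⁺ (inj₁ (from x∈⁅y⁆⇔x≡y (x₁-max w∈X (to ∈-tabulate w∈↑x₁))))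
      ... | no  w∉X = x∈p∪q⁺ (inj₂ (x∉p⇒x∈∁p w∉X))

    -- A minimal element y of ∁X below j has |↓y| > k ≥ |X| while ↓y ⊆ X ∪ {y}, so X ⊆ ↓y.
    X≼∁X : ∀ i j → i ∈ X → j ∉ X → i ≼ j
    X≼∁X i j i∈X j∉X with minimal-below (x∉p⇒x∈∁p j∉X)
    ... | y , (y∈∁X , y-min) , y≼j = ≼-trans (to ∈-tabulate (⁅y⁆∪X⊆↓y (x∈p∪q⁺ (inj₂ i∈X)))) y≼j
      where
      ↓y⊆⁅y⁆∪X : ↓ y ⊆ ⁅ y ⁆ ∪ X
      ↓y⊆⁅y⁆∪X {w} w∈↓y with w ∈? X
      ... | yes w∈X = x∈p∪q⁺ (inj₂ w∈X)
      ... | no  w∉X = x∈p∪q⁺ (inj₁ (from x∈⁅y⁆⇔x≡y (y-min (x∉p⇒x∈∁p w∉X) (to ∈-tabulate w∈↓y))))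

      ⁅y⁆∪X⊆↓y : ⁅ y ⁆ ∪ X ⊆ ↓ y
      ⁅y⁆∪X⊆↓y = p⊆q∧∣q∣≤∣p∣⇒q⊆p ↓y⊆⁅y⁆∪X (begin
        ∣ ⁅ y ⁆ ∪ X ∣      ≤⟨ ∣p∪q∣≤∣p∣+∣q∣ ⁅ y ⁆ X ⟩
        ∣ ⁅ y ⁆ ∣ + ∣ X ∣  ≡⟨ cong (_+ ∣ X ∣) (∣⁅x⁆∣≡1 y) ⟩
        suc ∣ X ∣          ≤⟨ s≤s ∣X∣≤k ⟩
        suc k              ≤⟨ ≰⇒> (x∈∁p⇒x∉p y∈∁X ∘ from ∈X⇔) ⟩
        ∣ ↓ y ∣            ∎)

-- Ordinal sums

module _ (P Q : FinRel) where
  private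
    p q : ℕ
    p = size P
    q = size Q
    module P = Order P
    module Q = Order Q
    module P⊕Q = Order (P ⊕ Q)

  rel-⊕-↑ˡ-↑ˡ : ∀ a b → rel (P ⊕ Q) (a ↑ˡ q) (b ↑ˡ q) ≡ rel P a b
  rel-⊕-↑ˡ-↑ˡ a b rewrite splitAt-↑ˡ p a q | splitAt-↑ˡ p b q = refl

  rel-⊕-↑ʳ-↑ʳ : ∀ a b → rel (P ⊕ Q) (p ↑ʳ a) (p ↑ʳ b) ≡ rel Q a b
  rel-⊕-↑ʳ-↑ʳ a b rewrite splitAt-↑ʳ p q a | splitAt-↑ʳ p q b = refl

  rel-⊕-↑ˡ-↑ʳ : ∀ a b → rel (P ⊕ Q) (a ↑ˡ q) (p ↑ʳ b) ≡ true
  rel-⊕-↑ˡ-↑ʳ a b rewrite splitAt-↑ˡ p a q | splitAt-↑ʳ p q b = refl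

  rel-⊕-↑ʳ-↑ˡ : ∀ a b → rel (P ⊕ Q) (p ↑ʳ a) (b ↑ˡ q) ≡ false
  rel-⊕-↑ʳ-↑ˡ a b rewrite splitAt-↑ʳ p q a | splitAt-↑ˡ p b q = refl

  data ⊕-View : Fin (p + q) → Set where
    inl : ∀ a → ⊕-View (a ↑ˡ q)
    inr : ∀ b → ⊕-View (p ↑ʳ b)

  ⊕-view : ∀ x → ⊕-View x
  ⊕-view x with splitAt p x in eq
  ... | inj₁ a = subst ⊕-View (splitAt⁻¹-↑ˡ eq) (inl a)
  ... | inj₂ b = subst ⊕-View (splitAt⁻¹-↑ʳ eq) (inr b)

  ∣↓∣-⊕-↑ˡ : ∀ a → ∣ P⊕Q.↓ (a ↑ˡ q) ∣ ≡ ∣ P.↓ a ∣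
  ∣↓∣-⊕-↑ˡ a = trans (∣tabulate∣-↑-cong p (λ w → rel-⊕-↑ˡ-↑ˡ w a) (λ w → rel-⊕-↑ʳ-↑ˡ w a))
    (trans (cong (∣ P.↓ a ∣ +_) (∣tabulate-false∣ q)) (+-identityʳ _))

  ∣↑∣-⊕-↑ˡ : ∀ a → ∣ P⊕Q.↑ (a ↑ˡ q) ∣ ≡ ∣ P.↑ a ∣ + q
  ∣↑∣-⊕-↑ˡ a = trans (∣tabulate∣-↑-cong p (rel-⊕-↑ˡ-↑ˡ a) (rel-⊕-↑ˡ-↑ʳ a))
    (cong (∣ P.↑ a ∣ +_) (∣tabulate-true∣ q))

  ∣↓∣-⊕-↑ʳ : ∀ b → ∣ P⊕Q.↓ (p ↑ʳ b) ∣ ≡ p + ∣ Q.↓ b ∣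
  ∣↓∣-⊕-↑ʳ b = trans (∣tabulate∣-↑-cong p (λ w → rel-⊕-↑ˡ-↑ʳ w b) (λ w → rel-⊕-↑ʳ-↑ʳ w b))
    (cong (_+ ∣ Q.↓ b ∣) (∣tabulate-true∣ p))

  ∣↑∣-⊕-↑ʳ : ∀ b → ∣ P⊕Q.↑ (p ↑ʳ b) ∣ ≡ ∣ Q.↑ b ∣
  ∣↑∣-⊕-↑ʳ b = trans (∣tabulate∣-↑-cong p (rel-⊕-↑ʳ-↑ˡ b) (rel-⊕-↑ʳ-↑ʳ b))
    (cong (_+ ∣ Q.↑ b ∣) (∣tabulate-false∣ p))

  isFinPoset-⊕ : IsFinPoset P → IsFinPoset Q → IsFinPoset (P ⊕ Q)
  isFinPoset-⊕ poP poQ = record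
    { isPreorder = record
      { isEquivalence = isEquivalence
      ; reflexive = λ { refl → ≼-refl _ }
      ; trans = ≼-trans (⊕-view _) (⊕-view _) (⊕-view _) }
    ; antisym = ≼-antisym (⊕-view _) (⊕-view _) }
    where
    module P′ = FinPoset poP
    module Q′ = FinPoset poQ

    ↑ˡ-≼-↑ˡ : ∀ {a b} → a P.≼ b ⇔ (a ↑ˡ q) P⊕Q.≼ (b ↑ˡ q)
    ↑ˡ-≼-↑ˡ {a} {b} = mk⇔ (subst T (sym (rel-⊕-↑ˡ-↑ˡ a b))) (subst T (rel-⊕-↑ˡ-↑ˡ a b))

    ↑ʳ-≼-↑ʳ : ∀ {a b} → a Q.≼ b ⇔ (p ↑ʳ a) P⊕Q.≼ (p ↑ʳ b)
    ↑ʳ-≼-↑ʳ {a} {b} = mk⇔ (subst T (sym (rel-⊕-↑ʳ-↑ʳ a b))) (subst T (rel-⊕-↑ʳ-↑ʳ a b))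

    ↑ʳ-⋠-↑ˡ : ∀ {a b} → ¬ (p ↑ʳ a) P⊕Q.≼ (b ↑ˡ q)
    ↑ʳ-⋠-↑ˡ {a} {b} = subst T (rel-⊕-↑ʳ-↑ˡ a b)

    ≼-refl : ∀ x → x P⊕Q.≼ x
    ≼-refl x with ⊕-view x
    ... | inl a = to ↑ˡ-≼-↑ˡ P′.≼-refl
    ... | inr b = to ↑ʳ-≼-↑ʳ Q′.≼-refl

    ≼-trans : ∀ {x y z} → ⊕-View x → ⊕-View y → ⊕-View z →
              x P⊕Q.≼ y → y P⊕Q.≼ z → x P⊕Q.≼ z
    ≼-trans (inl a) (inl b) (inl c) a≼b b≼c =
      to ↑ˡ-≼-↑ˡ (P′.≼-trans (from ↑ˡ-≼-↑ˡ a≼b) (from ↑ˡ-≼-↑ˡ b≼c))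
    ≼-trans (inr a) (inr b) (inr c) a≼b b≼c =
      to ↑ʳ-≼-↑ʳ (Q′.≼-trans (from ↑ʳ-≼-↑ʳ a≼b) (from ↑ʳ-≼-↑ʳ b≼c))
    ≼-trans (inl a) _       (inr c) _   _   = from T-≡ (rel-⊕-↑ˡ-↑ʳ a c)
    ≼-trans (inr a) (inl b) _       a≼b _   = contradiction a≼b ↑ʳ-⋠-↑ˡ
    ≼-trans _       (inr b) (inl c) _   b≼c = contradiction b≼c ↑ʳ-⋠-↑ˡ

    ≼-antisym : ∀ {x y} → ⊕-View x → ⊕-View y → x P⊕Q.≼ y → y P⊕Q.≼ x → x ≡ y
    ≼-antisym (inl a) (inl b) a≼b b≼a =
      cong (_↑ˡ q) (P′.antisym (from ↑ˡ-≼-↑ˡ a≼b) (from ↑ˡ-≼-↑ˡ b≼a))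
    ≼-antisym (inr a) (inr b) a≼b b≼a =
      cong (p ↑ʳ_) (Q′.antisym (from ↑ʳ-≼-↑ʳ a≼b) (from ↑ʳ-≼-↑ʳ b≼a))
    ≼-antisym (inl a) (inr b) _   b≼a = contradiction b≼a ↑ʳ-⋠-↑ˡ
    ≼-antisym (inr a) (inl b) a≼b _   = contradiction a≼b ↑ʳ-⋠-↑ˡ

  profile-⊕ : ∀ {c d} → Profile (P ⊕ Q) c d →
    (∃ λ d′ → Profile P c d′ × d ≡ d′ + q) ⊎ (∃ λ c′ → Profile Q c′ d × c ≡ p + c′)
  profile-⊕ (x , refl , refl) with ⊕-view x
  ... | inl a = inj₁ (_ , (a , sym (∣↓∣-⊕-↑ˡ a) , refl) , ∣↑∣-⊕-↑ˡ a)
  ... | inr b = inj₂ (_ , (b , refl , sym (∣↑∣-⊕-↑ʳ b)) , ∣↓∣-⊕-↑ʳ b)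

  profile-⊕⁺ˡ : ∀ {c d} → Profile P c d → Profile (P ⊕ Q) c (d + q)
  profile-⊕⁺ˡ (a , refl , refl) = a ↑ˡ q , ∣↓∣-⊕-↑ˡ a , ∣↑∣-⊕-↑ˡ a

  profile-⊕⁺ʳ : ∀ {c d} → Profile Q c d → Profile (P ⊕ Q) (p + c) d
  profile-⊕⁺ʳ (b , refl , refl) = p ↑ʳ b , ∣↓∣-⊕-↑ʳ b , ∣↑∣-⊕-↑ʳ b

isFinPoset-⨁ : ∀ {Ps} → All Component Ps → IsFinPoset (⨁ Ps)
isFinPoset-⨁ [] = record
  { isPreorder = record
    { isEquivalence = isEquivalence ; reflexive = λ { {()} } ; trans = λ { {()} } }
  ; antisym = λ { {()} } }
isFinPoset-⨁ ((po , _) ∷ cs) = isFinPoset-⊕ _ _ po (isFinPoset-⨁ cs)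

cutsAt-⊕ : ∀ {P Q} → IsFinPoset P → IsFinPoset Q → CutsAt (P ⊕ Q) (size P)
cutsAt-⊕ {P} {Q} poP poQ pr with profile-⊕ P Q pr
... | inj₁ (d , prP , refl) = mk⇔ (λ _ → p+q<d+q+p) (λ _ → proj₁ (profile-≤ prP))
  where
  p+q<d+q+p : size P + size Q < d + size Q + size P
  p+q<d+q+p = <-≤-trans (s≤s (≤-reflexive (+-comm (size P) (size Q))))
    (+-monoˡ-≤ (size P) (+-monoˡ-≤ (size Q) (proj₂ (FinPoset.profile-positive poP prP))))
... | inj₂ (c , prQ , refl) = mk⇔ (λ p+c≤p → contradiction p+c≤p (<⇒≱ p<p+c))
  (λ p+q<d+p → contradiction p+q<d+p (≤⇒≯ d+p≤p+q))
  where
  p<p+c : size P < size P + c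
  p<p+c = m<m+n (size P) (proj₁ (FinPoset.profile-positive poQ prQ))
  d+p≤p+q : _ + size P ≤ size P + size Q
  d+p≤p+q = ≤-trans (+-monoˡ-≤ (size P) (proj₂ (profile-≤ prQ)))
                    (≤-reflexive (+-comm (size Q) (size P)))

cutsAt-⊕⁻ : ∀ {P Q k} → CutsAt (P ⊕ Q) k → CutsAt P k
cutsAt-⊕⁻ {P} {Q} {k} cuts {d = d} pr = mk⇔
  (λ c≤k → +-cancelʳ-< (size Q) (size P) (d + k)
    (subst (size P + size Q <_) reorder (to (cuts (profile-⊕⁺ˡ P Q pr)) c≤k)))
  (λ p<d+k → from (cuts (profile-⊕⁺ˡ P Q pr))
    (subst (size P + size Q <_) (sym reorder) (+-monoˡ-< (size Q) p<d+k)))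
  where
  reorder : d + size Q + k ≡ d + k + size Q
  reorder = trans (+-assoc d (size Q) k)
    (trans (cong (d +_) (+-comm (size Q) k)) (sym (+-assoc d k (size Q))))

cutsAt-transfer : ∀ {P Q k} → size P ≡ size Q → (∀ {c d} → Profile Q c d → Profile P c d) →
  CutsAt P k → CutsAt Q k
cutsAt-transfer {k = k} |P|≡|Q| Q⇒P cuts pr = subst (λ n → _ ⇔ n < _ + k) |P|≡|Q| (cuts (Q⇒P pr))

profile-⊕-cancelˡ : ∀ {P T Q T′} → size P ≡ size Q → IsFinPoset T →
  (∀ {c d} → Profile (P ⊕ T) c d → Profile (Q ⊕ T′) c d) →
  ∀ {c d} → Profile T c d → Profile T′ c d
profile-⊕-cancelˡ {P} {T} {Q} {T′} |P|≡|Q| poT P⊕T⇒Q⊕T′ {c} {d} pr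
  with profile-⊕ Q T′ (P⊕T⇒Q⊕T′ (profile-⊕⁺ʳ P T pr))
... | inj₁ (_ , prQ , _) = contradiction (proj₁ (profile-≤ prQ))
  (<⇒≱ (subst (_< size P + c) |P|≡|Q| (m<m+n (size P) (proj₁ (FinPoset.profile-positive poT pr)))))
... | inj₂ (c′ , prT′ , p+c≡q+c′) =
  subst (λ c → Profile T′ c d)
    (sym (+-cancelˡ-≡ (size P) c c′ (trans p+c≡q+c′ (cong (_+ c′) (sym |P|≡|Q|))))) prT′

SameProfiles : FinRel → FinRel → Set
SameProfiles P Q = ∀ {c d} → Profile P c d ⇔ Profile Q c d

leading-component-≮ : ∀ {P T Q T′} → Component P → IsFinPoset T → Component Q →
  size (P ⊕ T) ≡ size (Q ⊕ T′) → SameProfiles (P ⊕ T) (Q ⊕ T′) → ¬ size P < size Q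
leading-component-≮ {P} {T} {Q} {T′} (poP , 0<|P| , _) poT (poQ , _ , indecomposableQ)
                    |P⊕T|≡|Q⊕T′| same |P|<|Q| =
  indecomposableQ (FinPoset.cutsAt⇒ordinallyDecomposable poQ 0<|P| |P|<|Q|
    (cutsAt-⊕⁻ {Q} {T′} (cutsAt-transfer |P⊕T|≡|Q⊕T′| (from same) (cutsAt-⊕ poP poT))))

sizes-determined : ∀ {Ps Qs} → All Component Ps → All Component Qs →
  size (⨁ Ps) ≡ size (⨁ Qs) → SameProfiles (⨁ Ps) (⨁ Qs) → map size Ps ≡ map size Qs
sizes-determined [] [] _ _ = refl
sizes-determined [] ((_ , 0<|Q| , _) ∷ _) 0≡|Q⊕T| _ =
  contradiction (≤-trans 0<|Q| (m≤m+n _ _)) (<-irrefl 0≡|Q⊕T|)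
sizes-determined ((_ , 0<|P| , _) ∷ _) [] |P⊕T|≡0 _ =
  contradiction (≤-trans 0<|P| (m≤m+n _ _)) (<-irrefl (sym |P⊕T|≡0))
sizes-determined {P ∷ Ps} {Q ∷ Qs} (cP ∷ cPs) (cQ ∷ cQs) |P⊕T|≡|Q⊕T′| same =
  cong₂ _∷_ |P|≡|Q| (sizes-determined cPs cQs |T|≡|T′|
    (mk⇔ (profile-⊕-cancelˡ |P|≡|Q| poT (to same))
         (profile-⊕-cancelˡ (sym |P|≡|Q|) poT′ (from same))))
  where
  poT : IsFinPoset (⨁ Ps)
  poT = isFinPoset-⨁ cPs
  poT′ : IsFinPoset (⨁ Qs)
  poT′ = isFinPoset-⨁ cQs
  |P|≡|Q| : size P ≡ size Q
  |P|≡|Q| = ≤-antisym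
    (≮⇒≥ (leading-component-≮ cQ poT′ cP (sym |P⊕T|≡|Q⊕T′|) (mk⇔ (from same) (to same))))
    (≮⇒≥ (leading-component-≮ cP poT cQ |P⊕T|≡|Q⊕T′| same))
  |T|≡|T′| : size (⨁ Ps) ≡ size (⨁ Qs)
  |T|≡|T′| = +-cancelˡ-≡ (size P) _ _ (trans |P⊕T|≡|Q⊕T′| (cong (_+ size (⨁ Qs)) (sym |P|≡|Q|)))

T-⇒ : ∀ {a b} → T (not a ∨ b) ⇔ (T a → T b)
T-⇒ {true}  = mk⇔ (λ tb _ → tb) (λ f → f tt)
T-⇒ {false} = mk⇔ (λ _ ()) (λ _ → tt)

T-does-≟ : ∀ {n} {w x : Fin n} → T (does (w ≟ x)) ⇔ w ≡ x
T-does-≟ {w = w} {x} with w ≟ x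
... | yes w≡x = mk⇔ (λ _ → w≡x) (λ _ → tt)
... | no  w≢x = mk⇔ (λ ()) w≢x

T-foldr-∧ : ∀ {A : Set} (f : A → Bool) xs → T (foldr (λ i acc → f i ∧ acc) true xs) ⇔ All (T ∘ f) xs
T-foldr-∧ f []       = mk⇔ (λ _ → []) (λ _ → tt)
T-foldr-∧ f (x ∷ xs) = ⇔.trans T-∧ (mk⇔ (λ (fx , rest) → fx ∷ to (T-foldr-∧ f xs) rest)
                                         (λ { (fx ∷ rest) → fx , from (T-foldr-∧ f xs) rest }))

T-all : ∀ {n} (f : Fin n → Bool) → T (foldr (λ i acc → f i ∧ acc) true (allFin n)) ⇔ (∀ i → T (f i))
T-all f = ⇔.trans (T-foldr-∧ f _)
  (mk⇔ (λ all i → All.lookup all (∈-allFin i)) (λ h → All.tabulate (λ {i} _ → h i)))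

∈⇔T-lookup : ∀ {n} {S : Subset n} {i} → i ∈ S ⇔ T (lookup S i)
∈⇔T-lookup {S = S} {i} = mk⇔ (from T-≡ ∘ []=⇒lookup) (lookup⇒[]= i S ∘ to T-≡)

length-filter-T? : ∀ {m n} (S : Subset n) (g : Fin m → Fin n) →
  length (filter (λ i → T? (lookup S i)) (List.tabulate g)) ≡ ∣ tabulate (lookup S ∘ g) ∣
length-filter-T? {zero}  S g = refl
length-filter-T? {suc m} S g with lookup S (g zero)
... | true  = cong suc (length-filter-T? S (g ∘ suc))
... | false = length-filter-T? S (g ∘ suc)

T-all-∧⇒ : ∀ {n} (f g h : Fin n → Bool) →
  T (foldr (λ i acc → (not (f i ∧ g i) ∨ h i) ∧ acc) true (allFin n)) ⇔
  (∀ {i} → T (f i) → T (g i) → T (h i))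
T-all-∧⇒ f g h = ⇔.trans (T-all _) (mk⇔
  (λ all {i} fi gi → to T-⇒ (all i) (from T-∧ (fi , gi)))
  (λ imp i → from T-⇒ (λ figi → imp (proj₁ (to T-∧ figi)) (proj₂ (to T-∧ figi)))))

T-closed : ∀ {n} (S : Subset n) (r : Fin n → Fin n → Bool) →
  T (foldr (λ i acc → foldr (λ j acc′ → (not (lookup S i ∧ r i j) ∨ lookup S j) ∧ acc′)
                            true (allFin n) ∧ acc) true (allFin n)) ⇔
  (∀ {i j} → i ∈ S → T (r i j) → j ∈ S)
T-closed {n} S r = ⇔.trans (T-all _) (mk⇔
  (λ all {i} {_} i∈S rij → from ∈⇔T-lookup (to (closed-at i) (all i) (to ∈⇔T-lookup i∈S) rij))
  (λ closed i → from (closed-at i) (λ Si rij → to ∈⇔T-lookup (closed (from ∈⇔T-lookup Si) rij))))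
  where
  closed-at : ∀ i → T (foldr (λ j acc → (not (lookup S i ∧ r i j) ∨ lookup S j) ∧ acc) true (allFin n)) ⇔
                 (∀ {j} → T (lookup S i) → T (r i j) → T (lookup S j))
  closed-at i = T-all-∧⇒ (λ _ → lookup S i) (r i) (lookup S)

module Reflect (P : FinRel) where
  open Order P

  card≡∣∣ : ∀ S → card P S ≡ ∣ S ∣
  card≡∣∣ S = trans (length-filter-T? S (λ i → i)) (cong ∣_∣ (tabulate∘lookup S))

  T-isUpset : ∀ {U} → T (isUpset P U) ⇔ IsUpset U
  T-isUpset {U} = T-closed U (rel P)

  T-isDownset : ∀ {D} → T (isDownset P D) ⇔ IsDownset D
  T-isDownset {D} = T-closed D (λ v u → rel P u v)

  ∈-minimals : ∀ {U x} → x ∈ minimals P U ⇔ IsMinimal _≼_ U x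
  ∈-minimals {U} {x} = ⇔.trans ∈-tabulate (⇔.trans T-∧ (⇔.sym ∈⇔T-lookup ×-⇔
    ⇔.trans (T-all-∧⇒ (lookup U) (λ w → rel P w x) (λ w → does (w ≟ x))) (mk⇔
    (λ imp {w} w∈U w≼x → to T-does-≟ (imp (to ∈⇔T-lookup w∈U) w≼x))
    (λ imp {w} w∈U w≼x → from T-does-≟ (imp (from ∈⇔T-lookup w∈U) w≼x)))))

  ∈-maximals : ∀ {D x} → x ∈ maximals P D ⇔ IsMaximal _≼_ D x
  ∈-maximals {D} {x} = ⇔.trans ∈-tabulate (⇔.trans T-∧ (⇔.sym ∈⇔T-lookup ×-⇔
    ⇔.trans (T-all-∧⇒ (lookup D) (rel P x) (λ w → does (w ≟ x))) (mk⇔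
    (λ imp {w} w∈D x≼w → to T-does-≟ (imp (to ∈⇔T-lookup w∈D) x≼w))
    (λ imp {w} w∈D x≼w → from T-does-≟ (imp (from ∈⇔T-lookup w∈D) x≼w)))))

  T-subsetB : ∀ {S S′} → T (subsetB P S S′) ⇔ S ⊆ S′
  T-subsetB = ⇔.trans (T-all _) (mk⇔
    (λ all {x} x∈S → from ∈⇔T-lookup (to T-⇒ (all x) (to ∈⇔T-lookup x∈S)))
    (λ S⊆S′ i → from T-⇒ (to ∈⇔T-lookup ∘ S⊆S′ ∘ from ∈⇔T-lookup)))

  ∈-inter : ∀ S S′ {x} → x ∈ inter P S S′ ⇔ (x ∈ S × x ∈ S′)
  ∈-inter _ _ = ⇔.trans ∈-tabulate (⇔.trans T-∧ (⇔.sym ∈⇔T-lookup ×-⇔ ⇔.sym ∈⇔T-lookup))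

  T-isPair : ∀ {U D} →
    T (isPair P U D) ⇔ (IsUpset U × IsDownset D × minimals P U ⊆ D × maximals P D ⊆ U)
  T-isPair = ⇔.trans T-∧ (T-isUpset ×-⇔
             ⇔.trans T-∧ (T-isDownset ×-⇔ ⇔.trans T-∧ (T-subsetB ×-⇔ T-subsetB)))

-- What Φ determines

0<length⇔∃∈ : ∀ {A : Set} {xs : List A} → 0 < length xs ⇔ ∃ (List._∈ xs)
0<length⇔∃∈ {xs = []}     = mk⇔ (λ ()) (λ { (_ , ()) })
0<length⇔∃∈ {xs = x ∷ xs} = mk⇔ (λ _ → x , here refl) (λ _ → s≤s z≤n)

∈-allSubsets : ∀ {n} (S : Subset n) → S List.∈ allSubsets n
∈-allSubsets []          = here refl
∈-allSubsets (true  ∷ S) = ∈-++⁺ˡ (∈-map⁺ (true ∷_) (∈-allSubsets S))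
∈-allSubsets (false ∷ S) = ∈-++⁺ʳ _ (∈-map⁺ (false ∷_) (∈-allSubsets S))

Contributes : (P : FinRel) → Subset (size P) → Subset (size P) → ℕ → ℕ → ℕ → ℕ → ℕ → Set
Contributes P U D a b c d e =
  T (isPair P U D) × ∣ minimals P U ∣ ≡ a × ∣ maximals P D ∣ ≡ b ×
  ∣ D ∣ ≡ c × ∣ U ∣ ≡ d × ∣ inter P U D ∣ ≡ e

module _ (P : FinRel) (a b c d e : ℕ) where
  private
    n : ℕ
    n = size P

    -- Definitionally equal to the condition filtered in Φ-coeff.
    matches : Subset n × Subset n → Bool
    matches (U , D) = isPair P U D
      ∧ (card P (minimals P U) ≡ᵇ a) ∧ (card P (maximals P D) ≡ᵇ b)
      ∧ (card P D ≡ᵇ c) ∧ (card P U ≡ᵇ d) ∧ (card P (inter P U D) ≡ᵇ e)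

    pairs : List (Subset n × Subset n)
    pairs = concatMap (λ U → map (λ D → U , D) (allSubsets n)) (allSubsets n)

    T-card≡ᵇ : ∀ S {m} → T (card P S ≡ᵇ m) ⇔ ∣ S ∣ ≡ m
    T-card≡ᵇ S {m} = mk⇔ (λ t → trans (sym (card≡∣∣ S)) (≡ᵇ⇒≡ _ m t))
                         (λ eq → ≡⇒≡ᵇ _ m (trans (card≡∣∣ S) eq))
      where open Reflect P

    T-matches : ∀ {U D} → T (matches (U , D)) ⇔ Contributes P U D a b c d e
    T-matches {U} {D} =
      ⇔.trans T-∧ (⇔.refl ×-⇔
      ⇔.trans T-∧ (T-card≡ᵇ (minimals P U) ×-⇔ ⇔.trans T-∧ (T-card≡ᵇ (maximals P D) ×-⇔
      ⇔.trans T-∧ (T-card≡ᵇ D ×-⇔ ⇔.trans T-∧ (T-card≡ᵇ U ×-⇔ T-card≡ᵇ (inter P U D))))))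

  0<Φ-coeff⇔ : 0 < Φ-coeff P a b c d e ⇔ ∃₂ λ U D → Contributes P U D a b c d e
  0<Φ-coeff⇔ = mk⇔ contributor-of contributor⇒0<Φ
    where
    contributor-of : 0 < Φ-coeff P a b c d e → ∃₂ λ U D → Contributes P U D a b c d e
    contributor-of 0<Φ with to (0<length⇔∃∈ {xs = filter (T? ∘ matches) pairs}) 0<Φ
    ... | (U , D) , UD∈ =
      U , D , to (T-matches {U} {D}) (proj₂ (∈-filter⁻ (T? ∘ matches) {xs = pairs} UD∈))

    ∈-pairs : ∀ U D → (U , D) List.∈ pairs
    ∈-pairs U D = ∈-concatMap⁺ (λ U → map (λ D → U , D) (allSubsets n))
      (Any.map (λ { refl → ∈-map⁺ (U ,_) (∈-allSubsets D) }) (∈-allSubsets U))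

    contributor⇒0<Φ : (∃₂ λ U D → Contributes P U D a b c d e) → 0 < Φ-coeff P a b c d e
    contributor⇒0<Φ (U , D , contributes) = from (0<length⇔∃∈ {xs = filter (T? ∘ matches) pairs})
      ((U , D) , ∈-filter⁺ (T? ∘ matches) (∈-pairs U D) (from (T-matches {U} {D}) contributes))

module _ {P : FinRel} (po : IsFinPoset P) where
  open FinPoset po
  open Reflect P

  minimals-↑ : ∀ {x} → minimals P (↑ x) ≡ ⁅ x ⁆
  minimals-↑ = x∈p∧unique⇒p≡⁅x⁆
    (from ∈-minimals (x∈↑x , λ w∈↑x w≼x → antisym w≼x (to ∈-tabulate w∈↑x)))
    (λ y∈min → let (y∈↑x , y-min) = to ∈-minimals y∈min in sym (y-min x∈↑x (to ∈-tabulate y∈↑x)))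

  upset-with-minimum : ∀ {U x} → IsUpset U → minimals P U ≡ ⁅ x ⁆ → U ≡ ↑ x
  upset-with-minimum {U} {x} up min≡⁅x⁆ = ⊆-antisym U⊆↑x (λ w∈↑x → up x∈U (to ∈-tabulate w∈↑x))
    where
    x∈U : x ∈ U
    x∈U = proj₁ (to ∈-minimals (from (∈-≡⁅x⁆ min≡⁅x⁆) refl))
    U⊆↑x : U ⊆ ↑ x
    U⊆↑x w∈U with minimal-below w∈U
    ... | m , m-min , m≼w =
      from ∈-tabulate (subst (_≼ _) (to (∈-≡⁅x⁆ min≡⁅x⁆) (from ∈-minimals m-min)) m≼w)

module _ {P : FinRel} (po : IsFinPoset P) where
  open FinPoset po
  open Reflect P

  maximals-↓ : ∀ {x} → maximals P (↓ x) ≡ ⁅ x ⁆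
  maximals-↓ = minimals-↑ {dual P} (Flip.isPartialOrder po)

  downset-with-maximum : ∀ {D x} → IsDownset D → maximals P D ≡ ⁅ x ⁆ → D ≡ ↓ x
  downset-with-maximum = upset-with-minimum {dual P} (Flip.isPartialOrder po)

  principal-contributes : ∀ x → Contributes P (↑ x) (↓ x) 1 1 (∣ ↓ x ∣) (∣ ↑ x ∣) 1
  principal-contributes x =
    from T-isPair (↑x-upset , ↓x-downset , min⊆↓x , max⊆↑x) ,
    trans (cong ∣_∣ (minimals-↑ po)) (∣⁅x⁆∣≡1 x) , trans (cong ∣_∣ maximals-↓) (∣⁅x⁆∣≡1 x) ,
    refl , refl , trans (cong ∣_∣ inter≡⁅x⁆) (∣⁅x⁆∣≡1 x)
    where
    ↑x-upset : IsUpset (↑ x)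
    ↑x-upset u∈↑x u≼v = from ∈-tabulate (≼-trans (to ∈-tabulate u∈↑x) u≼v)
    ↓x-downset : IsDownset (↓ x)
    ↓x-downset v∈↓x u≼v = from ∈-tabulate (≼-trans u≼v (to ∈-tabulate v∈↓x))
    min⊆↓x : minimals P (↑ x) ⊆ ↓ x
    min⊆↓x y∈min = subst (_∈ ↓ x) (sym (to (∈-≡⁅x⁆ (minimals-↑ po)) y∈min)) x∈↓x
    max⊆↑x : maximals P (↓ x) ⊆ ↑ x
    max⊆↑x y∈max = subst (_∈ ↑ x) (sym (to (∈-≡⁅x⁆ maximals-↓) y∈max)) x∈↑x
    inter≡⁅x⁆ : inter P (↑ x) (↓ x) ≡ ⁅ x ⁆
    inter≡⁅x⁆ = x∈p∧unique⇒p≡⁅x⁆ (from (∈-inter (↑ x) (↓ x)) (x∈↑x , x∈↓x))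
      (λ y∈ → let (y∈↑x , y∈↓x) = to (∈-inter (↑ x) (↓ x)) y∈
              in antisym (to ∈-tabulate y∈↓x) (to ∈-tabulate y∈↑x))

  -- The elements of A(U) and A(D) both lie in U ∩ D, so they coincide; call it x.  Then U = ↑x
  -- (every element of U is above a minimal one) and D = ↓x.
  contributor⇒profile : ∀ {c d} → (∃₂ λ U D → Contributes P U D 1 1 c d 1) → Profile P c d
  contributor⇒profile (U , D , pair , ∣minU∣≡1 , ∣maxD∣≡1 , refl , refl , ∣U∩D∣≡1)
    with to T-isPair pair | ∣p∣≡1⇒p≡⁅x⁆ (minimals P U) ∣minU∣≡1
       | ∣p∣≡1⇒p≡⁅x⁆ (maximals P D) ∣maxD∣≡1 | ∣p∣≡1⇒p≡⁅x⁆ (inter P U D) ∣U∩D∣≡1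
  ... | up , down , minU⊆D , maxD⊆U | x , minU≡⁅x⁆ | y , maxD≡⁅y⁆ | z , U∩D≡⁅z⁆ =
    x , cong ∣_∣ (sym D≡↓x) , cong ∣_∣ (sym U≡↑x)
    where
    x∈minU : x ∈ minimals P U
    x∈minU = from (∈-≡⁅x⁆ minU≡⁅x⁆) refl
    y∈maxD : y ∈ maximals P D
    y∈maxD = from (∈-≡⁅x⁆ maxD≡⁅y⁆) refl
    x≡y : x ≡ y
    x≡y = trans
      (to (∈-≡⁅x⁆ U∩D≡⁅z⁆) (from (∈-inter U D) (proj₁ (to ∈-minimals x∈minU) , minU⊆D x∈minU)))
      (sym (to (∈-≡⁅x⁆ U∩D≡⁅z⁆) (from (∈-inter U D) (maxD⊆U y∈maxD , proj₁ (to ∈-maximals y∈maxD)))))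
    U≡↑x : U ≡ ↑ x
    U≡↑x = upset-with-minimum po up minU≡⁅x⁆
    D≡↓x : D ≡ ↓ x
    D≡↓x = subst (λ w → D ≡ ↓ w) (sym x≡y) (downset-with-maximum down maxD≡⁅y⁆)

⊤⪯⊤-contributes : ∀ P →
  Contributes P ⊤ ⊤ (∣ minimals P ⊤ ∣) (∣ maximals P ⊤ ∣) (size P) (size P) (∣ inter P ⊤ ⊤ ∣)
⊤⪯⊤-contributes P =
  from (Reflect.T-isPair P) ((λ _ _ → ∈⊤) , (λ _ _ → ∈⊤) , (λ _ → ∈⊤) , (λ _ → ∈⊤)) ,
  refl , refl , ∣⊤∣≡n _ , ∣⊤∣≡n _ , refl

contributor-bound : ∀ {P a b c d e} → (∃₂ λ U D → Contributes P U D a b c d e) → c ≤ size P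
contributor-bound (_ , D , _ , _ , _ , refl , _) = ∣p∣≤n D

contributor-transfer : ∀ {P Q} a b c d e → SamePhi P Q →
  (∃₂ λ U D → Contributes P U D a b c d e) → ∃₂ λ U D → Contributes Q U D a b c d e
contributor-transfer {P} {Q} a b c d e same =
  to (0<Φ-coeff⇔ Q a b c d e) ∘ subst (0 <_) (same a b c d e) ∘ from (0<Φ-coeff⇔ P a b c d e)

size-≤ : ∀ {P Q} → SamePhi P Q → size P ≤ size Q
size-≤ {P} {Q} same = contributor-bound (contributor-transfer {P} {Q}
  (∣ minimals P ⊤ ∣) (∣ maximals P ⊤ ∣) (size P) (size P) (∣ inter P ⊤ ⊤ ∣) same
  (⊤ , ⊤ , ⊤⪯⊤-contributes P))

profile-determined : ∀ {P Q c d} → IsFinPoset P → IsFinPoset Q → SamePhi P Q →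
  Profile P c d → Profile Q c d
profile-determined {P} {Q} {c} {d} poP poQ same (x , refl , refl) =
  contributor⇒profile poQ
    (contributor-transfer {P} {Q} 1 1 c d 1 same (↑ x , ↓ x , principal-contributes poP x))
  where open Order P

SamePhi-sym : ∀ {P Q} → SamePhi P Q → SamePhi Q P
SamePhi-sym same a b c d e = sym (same a b c d e)

mainTheorem4 : (Ps Qs : List FinRel) → All Component Ps → All Component Qs →
    SamePhi (⨁ Ps) (⨁ Qs) → map size Ps ≡ map size Qs
mainTheorem4 Ps Qs cPs cQs same = sizes-determined cPs cQs
  (≤-antisym (size-≤ {P} {Q} same) (size-≤ {Q} {P} same′))
  (mk⇔ (profile-determined poP poQ same) (profile-determined poQ poP same′))
  where
  P Q : FinRel
  P = ⨁ Ps
  Q = ⨁ Qs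
  same′ : SamePhi Q P
  same′ = SamePhi-sym {P} {Q} same
  poP : IsFinPoset P
  poP = isFinPoset-⨁ cPs
  poQ : IsFinPoset Q
  poQ = isFinPoset-⨁ cQs
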